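{- The relation $\to_{R_2,ACh}$ is $ACh$-convergent: it is terminating, and for all terms $s,t$ with $s\approx_{R_2\cup ACh} t$ there exist terms $s',t'$ with $s\to^{!}_{R_2,ACh}s'$, $t\to^{!}_{R_2,ACh}t'$ and $s'\approx_{ACh}t'$.
   Context: Terms are built over the signature $\{+,h,0\}$, variables and free constants. $R_2$ is the rewrite system $x+x\to 0$, $x+0\to x$, $x+(y+x)\to y$, $h(0)\to 0$. $ACh$ is the equational theory generated by associativity and commutativity of $+$ and $h(x+y)\approx h(x)+h(y)$. For a rewrite system $R$ and equational theory $E$, $t\to_{R,E}t'$ iff there are a non-variable position $p$ of $t$, a rule $l\to r\in R$ and a substitution $\sigma$ with $t|_p=_E l\sigma$ and $t'=t[r\sigma]_p$; $s\to^{!}_{R,E}s'$ means $s\to^*_{R,E}s'$ and $s'$ is $\to_{R,E}$-irreducible. -}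

module Defs where

open import Data.Nat using (ℕ)
open import Data.Product using (_×_; ∃-syntax)
open import Relation.Nullary using (¬_)
open import Relation.Binary.Construct.Closure.ReflexiveTransitive using (Star)
open import Induction.WellFounded using (WellFounded)
open import Function using (flip)
open import Relation.Binary.PropositionalEquality using (_≡_)

infixl 6 _⊕_

data Term : Set where
  var  : ℕ → Term
  cst  : ℕ → Term
  𝟘    : Term
  h    : Term → Term
  _⊕_  : Term → Term → Term

Subst : Set
Subst = ℕ → Term

_⟨_⟩ : Term → Subst → Term
var x ⟨ σ ⟩ = σ x
cst c ⟨ σ ⟩ = cst c
𝟘 ⟨ σ ⟩ = 𝟘
h t ⟨ σ ⟩ = h (t ⟨ σ ⟩)
(t ⊕ u) ⟨ σ ⟩ = (t ⟨ σ ⟩) ⊕ (u ⟨ σ ⟩)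

x y z : Term
x = var 0
y = var 1
z = var 2

data R₂ : Term → Term → Set where
  r-nil   : R₂ (x ⊕ x) 𝟘
  r-unit  : R₂ (x ⊕ 𝟘) x
  r-canc  : R₂ (x ⊕ (y ⊕ x)) y
  r-h0    : R₂ (h 𝟘) 𝟘

data AChAx : Term → Term → Set where
  assoc : AChAx (x ⊕ (y ⊕ z)) ((x ⊕ y) ⊕ z)
  comm  : AChAx (x ⊕ y) (y ⊕ x)
  hdist : AChAx (h (x ⊕ y)) (h x ⊕ h y)

data EqTh (Ax : Term → Term → Set) : Term → Term → Set where
  ax    : ∀ {l r} → Ax l r → (σ : Subst) → EqTh Ax (l ⟨ σ ⟩) (r ⟨ σ ⟩)
  refl  : ∀ {t} → EqTh Ax t t
  sym   : ∀ {t u} → EqTh Ax t u → EqTh Ax u t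
  trans : ∀ {t u v} → EqTh Ax t u → EqTh Ax u v → EqTh Ax t v
  cong-h : ∀ {t u} → EqTh Ax t u → EqTh Ax (h t) (h u)
  cong-⊕ : ∀ {t t' u u'} → EqTh Ax t t' → EqTh Ax u u' → EqTh Ax (t ⊕ u) (t' ⊕ u')

_≈ACh_ : Term → Term → Set
_≈ACh_ = EqTh AChAx

data R₂∪ACh : Term → Term → Set where
  fromR   : ∀ {l r} → R₂ l r → R₂∪ACh l r
  fromACh : ∀ {l r} → AChAx l r → R₂∪ACh l r

_≈R₂ACh_ : Term → Term → Set
_≈R₂ACh_ = EqTh R₂∪ACh

IsVar : Term → Set
IsVar t = ∃[ n ] (t ≡ var n)

data RootStep (R : Term → Term → Set) (E : Term → Term → Set) : Term → Term → Set where
  root : ∀ {t l r} → ¬ IsVar t → R l r → (σ : Subst) → E t (l ⟨ σ ⟩) →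
         RootStep R E t (r ⟨ σ ⟩)

data Step (R : Term → Term → Set) (E : Term → Term → Set) : Term → Term → Set where
  here  : ∀ {t t'} → RootStep R E t t' → Step R E t t'
  in-h  : ∀ {t t'} → Step R E t t' → Step R E (h t) (h t')
  in-⊕ˡ : ∀ {t t' u} → Step R E t t' → Step R E (t ⊕ u) (t' ⊕ u)
  in-⊕ʳ : ∀ {t u u'} → Step R E u u' → Step R E (t ⊕ u) (t ⊕ u')

_⟶_ : Term → Term → Set
_⟶_ = Step R₂ _≈ACh_

Irreducible : Term → Set
Irreducible t = ∀ u → ¬ (t ⟶ u)

_⟶!_ : Term → Term → Set
s ⟶! s' = Star _⟶_ s s' × Irreducible s'

Terminating : Set
Terminating = WellFounded (flip _⟶_)

-- Termination: the weight μ, in which h doubles, is invariant under ACh and strictly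
-- decreased by every rule of R₂.
--
-- Confluence: modulo ACh a term is a sum of monomials h^j(q) over atoms q, and its
-- ACh-class is determined by how often each monomial occurs. An irreducible term is
-- 0 or a 0-free sum of pairwise distinct monomials. The parity of the number of
-- occurrences of each monomial with q ≠ 0 is invariant under R₂ ∪ ACh, so two
-- R₂ ∪ ACh-equal irreducible terms have the same occurrence counts, and are
-- therefore ACh-equal.
module Submission where

open import Defs
open import Data.Empty using (⊥; ⊥-elim)
open import Data.Nat.Base using (ℕ; zero; suc; _+_; _*_; _≤_; _<_; z≤n; s≤s; parity)
open import Data.Nat.Properties
open import Data.Nat.Induction using (<-wellFounded)
open import Data.Parity.Base as ℙ using (0ℙ)
open import Data.Parity.Properties using (+-homo-+; p+p≡0ℙ)
open import Data.Product using (_×_; ∃-syntax; _,_; proj₁; proj₂)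
open import Data.Sum using (_⊎_; inj₁; inj₂; [_,_]′)
open import Data.Unit using (⊤; tt)
open import Function using (flip; _on_; case_of_; _∘′_)
open import Induction.WellFounded using (Acc; acc; module Subrelation)
open import Level using (0ℓ)
open import Relation.Binary.Definitions using (DecidableEquality)
open import Relation.Binary.Bundles using (Setoid)
open import Relation.Binary.Structures using (IsEquivalence)
open import Relation.Binary.Construct.Closure.ReflexiveTransitive using (Star; ε; _◅_; fold)
import Relation.Binary.Construct.On as On
import Relation.Binary.Reasoning.Setoid as SetoidReasoning
open import Relation.Binary.PropositionalEquality as ≡ using (_≡_; refl; cong; cong₂; subst)
open import Relation.Nullary using (¬_; yes; no; map′)

data Atom : Set where
  V C : ℕ → Atom
  Z   : Atom

atom : Atom → Term
atom (V n) = var n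
atom (C n) = cst n
atom Z     = 𝟘

Nonzero : Atom → Set
Nonzero Z = ⊥
Nonzero _ = ⊤

_≟ᴬ_ : DecidableEquality Atom
V m ≟ᴬ V n = map′ (cong V) (λ { refl → refl }) (m ≟ n)
V m ≟ᴬ C n = no λ ()
V m ≟ᴬ Z   = no λ ()
C m ≟ᴬ V n = no λ ()
C m ≟ᴬ C n = map′ (cong C) (λ { refl → refl }) (m ≟ n)
C m ≟ᴬ Z   = no λ ()
Z   ≟ᴬ V n = no λ ()
Z   ≟ᴬ C n = no λ ()
Z   ≟ᴬ Z   = yes refl

mono : ℕ → Atom → Term
mono zero    q = atom q
mono (suc j) q = h (mono j q)

leafOcc : Atom → ℕ → Atom → ℕ
leafOcc a zero q with a ≟ᴬ q
... | yes _ = 1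
... | no  _ = 0
leafOcc a (suc j) q = 0

-- occ t j q is the number of occurrences of the monomial h^j(q) once h has been
-- distributed over + throughout t.
occ : Term → ℕ → Atom → ℕ
occ (var n) = leafOcc (V n)
occ (cst n) = leafOcc (C n)
occ 𝟘       = leafOcc Z
occ (h t) zero    q = 0
occ (h t) (suc j) q = occ t j q
occ (t ⊕ u) j q = occ t j q + occ u j q

μ : Term → ℕ
μ (var _) = 1
μ (cst _) = 1
μ 𝟘       = 1
μ (h t)   = 2 * μ t
μ (t ⊕ u) = μ t + μ u

σ₃ : Term → Term → Term → Subst
σ₃ a b c 0             = a
σ₃ a b c 1             = b
σ₃ a b c (suc (suc _)) = c

leafOcc-≤1 : ∀ a j q → leafOcc a j q ≤ 1
leafOcc-≤1 a zero q with a ≟ᴬ q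
... | yes _ = s≤s z≤n
... | no  _ = z≤n
leafOcc-≤1 a (suc j) q = z≤n

leafOcc-self : ∀ a → 0 < leafOcc a 0 a
leafOcc-self a with a ≟ᴬ a
... | yes _   = s≤s z≤n
... | no  a≢a = ⊥-elim (a≢a refl)

leafOcc-pos : ∀ {a j q} → 0 < leafOcc a j q → j ≡ 0 × a ≡ q
leafOcc-pos {a} {zero} {q} p with a ≟ᴬ q
... | yes a≡q = refl , a≡q
leafOcc-pos {a} {zero} {q} () | no _
leafOcc-pos {a} {suc j} ()

occ-𝟘 : ∀ j {q} → Nonzero q → occ 𝟘 j q ≡ 0
occ-𝟘 zero    {V _} _ = refl
occ-𝟘 zero    {C _} _ = refl
occ-𝟘 (suc j)       _ = refl

occ-h𝟘 : ∀ j {q} → Nonzero q → occ (h 𝟘) j q ≡ 0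
occ-h𝟘 zero    _  = refl
occ-h𝟘 (suc j) nz = occ-𝟘 j nz

occurs-some : ∀ t → ∃[ j ] ∃[ q ] 0 < occ t j q
occurs-some (var n) = 0 , V n , leafOcc-self (V n)
occurs-some (cst n) = 0 , C n , leafOcc-self (C n)
occurs-some 𝟘       = 0 , Z , leafOcc-self Z
occurs-some (h t) with occurs-some t
... | j , q , p = suc j , q , p
occurs-some (t ⊕ u) with occurs-some t
... | j , q , p = j , q , ≤-trans p (m≤m+n _ _)

+-pos : ∀ m {n} → 0 < m + n → 0 < m ⊎ 0 < n
+-pos zero    p = inj₂ p
+-pos (suc m) _ = inj₁ (s≤s z≤n)

μ-pos : ∀ t → 0 < μ t
μ-pos (var _) = s≤s z≤n
μ-pos (cst _) = s≤s z≤n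
μ-pos 𝟘       = s≤s z≤n
μ-pos (h t)   = ≤-trans (μ-pos t) (m≤n*m (μ t) 2)
μ-pos (t ⊕ u) = ≤-trans (μ-pos t) (m≤m+n _ _)

record IsCongruence (_∼_ : Term → Term → Set) : Set where
  field
    isEquivalence : IsEquivalence _∼_
    h-cong        : ∀ {t u} → t ∼ u → h t ∼ h u
    ⊕-cong        : ∀ {t t′ u u′} → t ∼ t′ → u ∼ u′ → (t ⊕ u) ∼ (t′ ⊕ u′)

EqTh-least : ∀ {Ax _∼_} → IsCongruence _∼_ →
             (∀ {l r} → Ax l r → ∀ σ → (l ⟨ σ ⟩) ∼ (r ⟨ σ ⟩)) →
             ∀ {s t} → EqTh Ax s t → s ∼ t
EqTh-least {Ax} {_∼_} c axioms = go
  where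
  open IsCongruence c
  module ∼ = IsEquivalence isEquivalence
  go : ∀ {s t} → EqTh Ax s t → s ∼ t
  go (ax a σ)     = axioms a σ
  go refl         = ∼.refl
  go (sym e)      = ∼.sym (go e)
  go (trans e e′) = ∼.trans (go e) (go e′)
  go (cong-h e)   = h-cong (go e)
  go (cong-⊕ e e′) = ⊕-cong (go e) (go e′)

EqTh-isCongruence : ∀ {Ax} → IsCongruence (EqTh Ax)
EqTh-isCongruence = record
  { isEquivalence = record { refl = refl ; sym = sym ; trans = trans }
  ; h-cong        = cong-h
  ; ⊕-cong        = cong-⊕
  }

μ-isCongruence : IsCongruence (_≡_ on μ)
μ-isCongruence = record
  { isEquivalence = On.isEquivalence μ ≡.isEquivalence
  ; h-cong        = cong (2 *_)
  ; ⊕-cong        = cong₂ _+_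
  }

SameOcc : Term → Term → Set
SameOcc s t = ∀ j q → occ s j q ≡ occ t j q

sameOcc-isCongruence : IsCongruence SameOcc
sameOcc-isCongruence = record
  { isEquivalence = record
    { refl  = λ _ _ → refl
    ; sym   = λ e j q → ≡.sym (e j q)
    ; trans = λ e e′ j q → ≡.trans (e j q) (e′ j q)
    }
  ; h-cong        = λ { e zero q → refl ; e (suc j) q → e j q }
  ; ⊕-cong        = λ e e′ j q → cong₂ _+_ (e j q) (e′ j q)
  }

SameParity : Term → Term → Set
SameParity s t = ∀ j q → Nonzero q → parity (occ s j q) ≡ parity (occ t j q)

sameParity-isCongruence : IsCongruence SameParity
sameParity-isCongruence = record
  { isEquivalence = record
    { refl  = λ _ _ _ → refl
    ; sym   = λ e j q nz → ≡.sym (e j q nz)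
    ; trans = λ e e′ j q nz → ≡.trans (e j q nz) (e′ j q nz)
    }
  ; h-cong = λ { e zero q nz → refl ; e (suc j) q nz → e j q nz }
  ; ⊕-cong = λ {t} {t′} {u} {u′} e e′ j q nz → begin
      parity (occ t j q + occ u j q)              ≡⟨ +-homo-+ (occ t j q) _ ⟩
      parity (occ t j q) ℙ.+ parity (occ u j q)   ≡⟨ cong₂ ℙ._+_ (e j q nz) (e′ j q nz) ⟩
      parity (occ t′ j q) ℙ.+ parity (occ u′ j q) ≡⟨ +-homo-+ (occ t′ j q) _ ⟨
      parity (occ t′ j q + occ u′ j q)            ∎
  }
  where open ≡.≡-Reasoning

μ-AChAx : ∀ {l r} → AChAx l r → ∀ σ → μ (l ⟨ σ ⟩) ≡ μ (r ⟨ σ ⟩)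
μ-AChAx assoc σ = ≡.sym (+-assoc (μ (σ 0)) _ _)
μ-AChAx comm  σ = +-comm (μ (σ 0)) _
μ-AChAx hdist σ = *-distribˡ-+ 2 (μ (σ 0)) (μ (σ 1))

occ-AChAx : ∀ {l r} → AChAx l r → ∀ σ → SameOcc (l ⟨ σ ⟩) (r ⟨ σ ⟩)
occ-AChAx assoc σ j       q = ≡.sym (+-assoc (occ (σ 0) j q) _ _)
occ-AChAx comm  σ j       q = +-comm (occ (σ 0) j q) _
occ-AChAx hdist σ zero    q = refl
occ-AChAx hdist σ (suc j) q = refl

parity-double : ∀ n → parity (n + n) ≡ 0ℙ
parity-double n = ≡.trans (+-homo-+ n n) (p+p≡0ℙ (parity n))

parity-R₂ : ∀ {l r} → R₂ l r → ∀ σ → SameParity (l ⟨ σ ⟩) (r ⟨ σ ⟩)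
parity-R₂ r-nil σ j q nz =
  ≡.trans (parity-double (occ (σ 0) j q)) (cong parity (≡.sym (occ-𝟘 j nz)))
parity-R₂ r-unit σ j q nz =
  cong parity (≡.trans (cong (occ (σ 0) j q +_) (occ-𝟘 j nz)) (+-identityʳ _))
parity-R₂ r-canc σ j q nz = begin
  parity (a + (b + a))        ≡⟨ cong (λ n → parity (a + n)) (+-comm b a) ⟩
  parity (a + (a + b))        ≡⟨ cong parity (+-assoc a a b) ⟨
  parity (a + a + b)          ≡⟨ +-homo-+ (a + a) b ⟩
  parity (a + a) ℙ.+ parity b ≡⟨ cong (ℙ._+ parity b) (parity-double a) ⟩
  parity b                    ∎
  where
  open ≡.≡-Reasoning
  a = occ (σ 0) j q
  b = occ (σ 1) j q
parity-R₂ r-h0 σ j q nz = cong parity (≡.trans (occ-h𝟘 j nz) (≡.sym (occ-𝟘 j nz)))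

μ-≈ACh : ∀ {s t} → s ≈ACh t → μ s ≡ μ t
μ-≈ACh = EqTh-least μ-isCongruence μ-AChAx

occ-≈ACh : ∀ {s t} → s ≈ACh t → SameOcc s t
occ-≈ACh = EqTh-least sameOcc-isCongruence occ-AChAx

≈ACh⇒≈R₂ACh : ∀ {s t} → s ≈ACh t → s ≈R₂ACh t
≈ACh⇒≈R₂ACh = EqTh-least EqTh-isCongruence (λ a → ax (fromACh a))

parity-≈R₂ACh : ∀ {s t} → s ≈R₂ACh t → SameParity s t
parity-≈R₂ACh = EqTh-least sameParity-isCongruence axioms
  where
  axioms : ∀ {l r} → R₂∪ACh l r → ∀ σ → SameParity (l ⟨ σ ⟩) (r ⟨ σ ⟩)
  axioms (fromR r)   σ = parity-R₂ r σ
  axioms (fromACh a) σ j q _ = cong parity (occ-AChAx a σ j q)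

μ-R₂ : ∀ {l r} → R₂ l r → ∀ σ → μ (r ⟨ σ ⟩) < μ (l ⟨ σ ⟩)
μ-R₂ r-nil  σ = +-mono-≤ (μ-pos (σ 0)) (μ-pos (σ 0))
μ-R₂ r-unit σ = m<m+n (μ (σ 0)) (s≤s z≤n)
μ-R₂ r-canc σ = <-≤-trans (m<m+n (μ (σ 1)) (μ-pos (σ 0))) (m≤n+m _ (μ (σ 0)))
μ-R₂ r-h0   σ = ≤-refl

μ-⟶ : ∀ {t u} → t ⟶ u → μ u < μ t
μ-⟶ (here (root _ rule σ e)) = subst (_ <_) (≡.sym (μ-≈ACh e)) (μ-R₂ rule σ)
μ-⟶ (in-h st)                = *-monoʳ-< 2 (μ-⟶ st)
μ-⟶ (in-⊕ˡ {u = w} st)       = +-monoˡ-< (μ w) (μ-⟶ st)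
μ-⟶ (in-⊕ʳ {t = w} st)       = +-monoʳ-< (μ w) (μ-⟶ st)

terminating : Terminating
terminating = Subrelation.wellFounded μ-⟶ (On.wellFounded μ <-wellFounded)

⟶⇒≈R₂ACh : ∀ {t u} → t ⟶ u → t ≈R₂ACh u
⟶⇒≈R₂ACh (here (root _ rule σ e)) = trans (≈ACh⇒≈R₂ACh e) (ax (fromR rule) σ)
⟶⇒≈R₂ACh (in-h st)  = cong-h (⟶⇒≈R₂ACh st)
⟶⇒≈R₂ACh (in-⊕ˡ st) = cong-⊕ (⟶⇒≈R₂ACh st) refl
⟶⇒≈R₂ACh (in-⊕ʳ st) = cong-⊕ refl (⟶⇒≈R₂ACh st)

⟶*⇒≈R₂ACh : ∀ {t u} → Star _⟶_ t u → t ≈R₂ACh u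
⟶*⇒≈R₂ACh = fold _≈R₂ACh_ (λ st e → trans (⟶⇒≈R₂ACh st) e) refl

⊕-assoc : ∀ a b c → (a ⊕ (b ⊕ c)) ≈ACh ((a ⊕ b) ⊕ c)
⊕-assoc a b c = ax assoc (σ₃ a b c)

⊕-comm : ∀ a b → (a ⊕ b) ≈ACh (b ⊕ a)
⊕-comm a b = ax comm (σ₃ a b a)

h-distrib : ∀ a b → h (a ⊕ b) ≈ACh (h a ⊕ h b)
h-distrib a b = ax hdist (σ₃ a b a)

≈ACh-setoid : Setoid 0ℓ 0ℓ
≈ACh-setoid = record { isEquivalence = IsCongruence.isEquivalence (EqTh-isCongruence {AChAx}) }

module ≈ACh-Reasoning = SetoidReasoning ≈ACh-setoid

Summand : Term → Term → Set
Summand m t = t ≈ACh m ⊎ ∃[ r ] t ≈ACh (m ⊕ r)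

summand-resp-≈ACh : ∀ {m t t′} → t ≈ACh t′ → Summand m t → Summand m t′
summand-resp-≈ACh t≈t′ (inj₁ e)       = inj₁ (trans (sym t≈t′) e)
summand-resp-≈ACh t≈t′ (inj₂ (r , e)) = inj₂ (r , trans (sym t≈t′) e)

summand-h : ∀ {m t} → Summand m t → Summand (h m) (h t)
summand-h         (inj₁ e)       = inj₁ (cong-h e)
summand-h {m = m} (inj₂ (r , e)) = inj₂ (h r , trans (cong-h e) (h-distrib m r))

summand-⊕ˡ : ∀ {m t} u → Summand m t → Summand m (t ⊕ u)
summand-⊕ˡ         u (inj₁ e)       = inj₂ (u , cong-⊕ e refl)
summand-⊕ˡ {m = m} u (inj₂ (r , e)) = inj₂ (r ⊕ u , trans (cong-⊕ e refl) (sym (⊕-assoc m r u)))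

summand-⊕ʳ : ∀ {m u} t → Summand m u → Summand m (t ⊕ u)
summand-⊕ʳ {u = u} t s = summand-resp-≈ACh (⊕-comm u t) (summand-⊕ˡ t s)

leaf-summand : ∀ a {j q} → 0 < leafOcc a j q → Summand (mono j q) (atom a)
leaf-summand a {j} {q} p with leafOcc-pos {a} {j} {q} p
... | refl , refl = inj₁ refl

occurs⇒summand : ∀ t {j q} → 0 < occ t j q → Summand (mono j q) t
occurs⇒summand (var n) {j} {q} = leaf-summand (V n) {j} {q}
occurs⇒summand (cst n) {j} {q} = leaf-summand (C n) {j} {q}
occurs⇒summand 𝟘       {j} {q} = leaf-summand Z {j} {q}
occurs⇒summand (h t) {suc j} p = summand-h (occurs⇒summand t p)
occurs⇒summand (t ⊕ u) {j} {q} p =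
  [ summand-⊕ˡ u ∘′ occurs⇒summand t , summand-⊕ʳ t ∘′ occurs⇒summand u ]′ (+-pos (occ t j q) p)

¬sameOcc-⊕ : ∀ {a b m r} → a ≈ACh m → b ≈ACh (m ⊕ r) → ¬ SameOcc a b
¬sameOcc-⊕ {m = m} {r} a≈m b≈m⊕r same with occurs-some r
... | j , q , p = <-irrefl m≡m+r (m<m+n (occ m j q) p)
  where
  m≡m+r : occ m j q ≡ occ m j q + occ r j q
  m≡m+r = ≡.trans (≡.sym (occ-≈ACh a≈m j q)) (≡.trans (same j q) (occ-≈ACh b≈m⊕r j q))

-- Peel off a common monomial and recurse on the lighter remainders.
≈ACh-complete : ∀ a b → SameOcc a b → a ≈ACh b
≈ACh-complete a b = go a b (<-wellFounded (μ a))
  where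
  go : ∀ a b → Acc _<_ (μ a) → SameOcc a b → a ≈ACh b
  go a b (acc smaller) same with occurs-some a
  ... | j , q , p = cases (occurs⇒summand a p) (occurs⇒summand b (subst (0 <_) (same j q) p))
    where
    m = mono j q
    cases : Summand m a → Summand m b → a ≈ACh b
    cases (inj₁ ea)       (inj₁ eb)       = trans ea (sym eb)
    cases (inj₁ ea)       (inj₂ (_ , eb)) = ⊥-elim (¬sameOcc-⊕ ea eb same)
    cases (inj₂ (_ , ea)) (inj₁ eb)       = ⊥-elim (¬sameOcc-⊕ eb ea λ j q → ≡.sym (same j q))
    cases (inj₂ (r , ea)) (inj₂ (r′ , eb)) =
      trans ea (trans (cong-⊕ refl (go r r′ (smaller r<a) same′)) (sym eb))
      where
      same′ : SameOcc r r′
      same′ j q = +-cancelˡ-≡ (occ m j q) _ _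
        (≡.trans (≡.sym (occ-≈ACh ea j q)) (≡.trans (same j q) (occ-≈ACh eb j q)))
      r<a : μ r < μ a
      r<a = <-≤-trans (m<n+m (μ r) (μ-pos m)) (≤-reflexive (≡.sym (μ-≈ACh ea)))

AtMostOnce : Term → Set
AtMostOnce t = ∀ j q → occ t j q ≤ 1

ZeroFree : Term → Set
ZeroFree t = ∀ j → occ t j Z ≡ 0

record Reduced (t : Term) : Set where
  field
    atMostOnce     : AtMostOnce t
    𝟘-or-zeroFree : t ≡ 𝟘 ⊎ ZeroFree t

open Reduced

atMostOnce-⊕-disjoint : ∀ {t u j q} → AtMostOnce (t ⊕ u) → 0 < occ t j q → 0 < occ u j q → ⊥
atMostOnce-⊕-disjoint {j = j} {q} once pt pu = 1+n≰n (≤-trans (+-mono-≤ pt pu) (once j q))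

atMostOnce-≈ACh : ∀ {t u} → t ≈ACh u → AtMostOnce t → AtMostOnce u
atMostOnce-≈ACh e once j q = subst (_≤ 1) (occ-≈ACh e j q) (once j q)

zeroFree-nonzero : ∀ {t j q} → ZeroFree t → 0 < occ t j q → Nonzero q
zeroFree-nonzero {q = V _} _ _ = tt
zeroFree-nonzero {q = C _} _ _ = tt
zeroFree-nonzero {j = j} {Z} zf p = n≮0 (subst (0 <_) (zf j) p)

reduced-below : ∀ {t u} → (∀ j q → occ t j q ≤ occ u j q) → AtMostOnce u → ZeroFree u → Reduced t
reduced-below t≤u once zf = record
  { atMostOnce    = λ j q → ≤-trans (t≤u j q) (once j q)
  ; 𝟘-or-zeroFree = inj₂ λ j → n≤0⇒n≡0 (≤-trans (t≤u j Z) (≤-reflexive (zf j)))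
  }

reduced-h⁻¹ : ∀ {t} → Reduced (h t) → Reduced t
reduced-h⁻¹ rt with 𝟘-or-zeroFree rt
... | inj₂ zf = record
  { atMostOnce    = λ j → atMostOnce rt (suc j)
  ; 𝟘-or-zeroFree = inj₂ λ j → zf (suc j)
  }

reduced-⊕⁻¹ : ∀ {t u} → Reduced (t ⊕ u) → Reduced t × Reduced u
reduced-⊕⁻¹ {t} {u} rt with 𝟘-or-zeroFree rt
... | inj₂ zf = reduced-below {u = t ⊕ u} (λ _ _ → m≤m+n _ _) (atMostOnce rt) zf
              , reduced-below {u = t ⊕ u} (λ _ _ → m≤n+m _ _) (atMostOnce rt) zf

𝟘≉⊕ : ∀ {a b} → ¬ 𝟘 ≈ACh (a ⊕ b)
𝟘≉⊕ {a} {b} e = 1+n≰n (≤-trans (+-mono-≤ (μ-pos a) (μ-pos b)) (≤-reflexive (≡.sym (μ-≈ACh e))))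

zeroFree-≉⊕𝟘 : ∀ {t a} → ZeroFree t → ¬ t ≈ACh (a ⊕ 𝟘)
zeroFree-≉⊕𝟘 {a = a} zf e =
  case ≡.trans (≡.sym (zf 0)) (≡.trans (occ-≈ACh e 0 Z) (+-comm (occ a 0 Z) 1)) of λ ()

reduced-no-h𝟘 : ∀ {t} → Reduced t → occ t 1 Z ≡ 0
reduced-no-h𝟘 rt with 𝟘-or-zeroFree rt
... | inj₁ refl = refl
... | inj₂ zf   = zf 1

reduced-irreducible : ∀ {t} → Reduced t → Irreducible t
reduced-irreducible rt _ (here (root _ r-nil σ e)) with occurs-some (σ 0)
... | j , q , p = atMostOnce-⊕-disjoint {σ 0} {σ 0} (atMostOnce-≈ACh e (atMostOnce rt)) p p
reduced-irreducible rt _ (here (root _ r-canc σ e)) with occurs-some (σ 0)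
... | j , q , p = atMostOnce-⊕-disjoint {σ 0} {σ 1 ⊕ σ 0} (atMostOnce-≈ACh e (atMostOnce rt))
                    p (≤-trans p (m≤n+m _ _))
reduced-irreducible rt _ (here (root _ r-h0 σ e)) =
  case ≡.trans (≡.sym (reduced-no-h𝟘 rt)) (occ-≈ACh e 1 Z) of λ ()
reduced-irreducible rt _ (here (root _ r-unit σ e)) with 𝟘-or-zeroFree rt
... | inj₁ refl = 𝟘≉⊕ e
... | inj₂ zf   = zeroFree-≉⊕𝟘 zf e
reduced-irreducible rt _ (in-h st)  = reduced-irreducible (reduced-h⁻¹ rt) _ st
reduced-irreducible rt _ (in-⊕ˡ st) = reduced-irreducible (proj₁ (reduced-⊕⁻¹ rt)) _ st
reduced-irreducible rt _ (in-⊕ʳ st) = reduced-irreducible (proj₂ (reduced-⊕⁻¹ rt)) _ st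

Meets : (ℕ → Atom → ℕ) → (ℕ → Atom → ℕ) → Set
Meets g f = ∃[ j ] ∃[ q ] 0 < g j q × 0 < f j q

Avoids : (ℕ → Atom → ℕ) → (ℕ → Atom → ℕ) → Set
Avoids g f = ∀ j q → 0 < g j q → f j q ≡ 0

leaf-meets-or-avoids : ∀ a f → Meets (leafOcc a) f ⊎ Avoids (leafOcc a) f
leaf-meets-or-avoids a f with 0 <? f 0 a
... | yes p = inj₁ (0 , a , leafOcc-self a , p)
... | no ¬p = inj₂ avoids
  where
  avoids : Avoids (leafOcc a) f
  avoids j q o with leafOcc-pos {a} {j} {q} o
  ... | refl , refl = n≤0⇒n≡0 (≮⇒≥ ¬p)

meets-or-avoids : ∀ t f → Meets (occ t) f ⊎ Avoids (occ t) f
meets-or-avoids (var n) = leaf-meets-or-avoids (V n)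
meets-or-avoids (cst n) = leaf-meets-or-avoids (C n)
meets-or-avoids 𝟘       = leaf-meets-or-avoids Z
meets-or-avoids (h t) f with meets-or-avoids t (λ j → f (suc j))
... | inj₁ (j , q , pt , pf) = inj₁ (suc j , q , pt , pf)
... | inj₂ avoids = inj₂ λ { zero q () ; (suc j) q → avoids j q }
meets-or-avoids (t ⊕ u) f with meets-or-avoids t f | meets-or-avoids u f
... | inj₁ (j , q , pt , pf) | _ = inj₁ (j , q , ≤-trans pt (m≤m+n _ _) , pf)
... | inj₂ _ | inj₁ (j , q , pu , pf) = inj₁ (j , q , ≤-trans pu (m≤n+m _ _) , pf)
... | inj₂ avoidsT | inj₂ avoidsU =
  inj₂ λ j q o → [ avoidsT j q , avoidsU j q ]′ (+-pos (occ t j q) o)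

Reducible : Term → Set
Reducible t = ∃[ u ] t ⟶ u

⊕-reducible : ∀ {t u l r} → R₂ l r → ∀ σ → (t ⊕ u) ≈ACh (l ⟨ σ ⟩) → Reducible (t ⊕ u)
⊕-reducible rule σ e = _ , here (root (λ { (_ , ()) }) rule σ e)

summands-cancel : ∀ {m t u} → Summand m t → Summand m u → Reducible (t ⊕ u)
summands-cancel {m} (inj₁ t≈m) (inj₁ u≈m) = ⊕-reducible r-nil (σ₃ m m m) (cong-⊕ t≈m u≈m)
summands-cancel {m} (inj₁ t≈m) (inj₂ (r′ , u≈m⊕r′)) =
  ⊕-reducible r-canc (σ₃ m r′ m) (trans (cong-⊕ t≈m u≈m⊕r′) (cong-⊕ refl (⊕-comm m r′)))
summands-cancel {m} (inj₂ (r , t≈m⊕r)) (inj₁ u≈m) =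
  ⊕-reducible r-canc (σ₃ m r m) (trans (cong-⊕ t≈m⊕r u≈m) (sym (⊕-assoc m r m)))
summands-cancel {m} (inj₂ (r , t≈m⊕r)) (inj₂ (r′ , u≈m⊕r′)) =
  ⊕-reducible r-canc (σ₃ m (r ⊕ r′) m) (trans (cong-⊕ t≈m⊕r u≈m⊕r′) (begin
    (m ⊕ r) ⊕ (m ⊕ r′) ≈⟨ sym (⊕-assoc m r _) ⟩
    m ⊕ (r ⊕ (m ⊕ r′)) ≈⟨ cong-⊕ refl (cong-⊕ refl (⊕-comm m r′)) ⟩
    m ⊕ (r ⊕ (r′ ⊕ m)) ≈⟨ cong-⊕ refl (⊕-assoc r r′ m) ⟩
    m ⊕ ((r ⊕ r′) ⊕ m) ∎))
  where open ≈ACh-Reasoning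

atom-reduced : ∀ a → Reduced (atom a)
atom-reduced Z     = record { atMostOnce = leafOcc-≤1 Z ; 𝟘-or-zeroFree = inj₁ refl }
atom-reduced (V n) = record
  { atMostOnce    = leafOcc-≤1 (V n)
  ; 𝟘-or-zeroFree = inj₂ λ { zero → refl ; (suc _) → refl }
  }
atom-reduced (C n) = record
  { atMostOnce    = leafOcc-≤1 (C n)
  ; 𝟘-or-zeroFree = inj₂ λ { zero → refl ; (suc _) → refl }
  }

h-reduced : ∀ {t} → AtMostOnce t → ZeroFree t → Reduced (h t)
h-reduced once zf = record
  { atMostOnce    = λ { zero q → z≤n ; (suc j) → once j }
  ; 𝟘-or-zeroFree = inj₂ λ { zero → refl ; (suc j) → zf j }
  }

sum≤1 : ∀ {m n} → m ≤ 1 → n ≤ 1 → (0 < m → n ≡ 0) → m + n ≤ 1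
sum≤1 z≤n       n≤1 _ = n≤1
sum≤1 (s≤s z≤n) _   f rewrite f (s≤s z≤n) = s≤s z≤n

⊕-reduced : ∀ {t u} → Avoids (occ t) (occ u) → AtMostOnce t → AtMostOnce u →
            ZeroFree t → ZeroFree u → Reduced (t ⊕ u)
⊕-reduced avoids onceT onceU zfT zfU = record
  { atMostOnce    = λ j q → sum≤1 (onceT j q) (onceU j q) (avoids j q)
  ; 𝟘-or-zeroFree = inj₂ λ j → cong₂ _+_ (zfT j) (zfU j)
  }

reduced-or-reducible : ∀ t → Reduced t ⊎ Reducible t
reduced-or-reducible (var n) = inj₁ (atom-reduced (V n))
reduced-or-reducible (cst n) = inj₁ (atom-reduced (C n))
reduced-or-reducible 𝟘       = inj₁ (atom-reduced Z)
reduced-or-reducible (h t) with reduced-or-reducible t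
... | inj₂ (u , t⟶u) = inj₂ (h u , in-h t⟶u)
... | inj₁ rt with 𝟘-or-zeroFree rt
...   | inj₁ refl = inj₂ (𝟘 , here (root (λ { (_ , ()) }) r-h0 (σ₃ 𝟘 𝟘 𝟘) refl))
...   | inj₂ zf   = inj₁ (h-reduced (atMostOnce rt) zf)
reduced-or-reducible (t ⊕ u) with reduced-or-reducible t | reduced-or-reducible u
... | inj₂ (t′ , t⟶t′) | _ = inj₂ (t′ ⊕ u , in-⊕ˡ t⟶t′)
... | inj₁ _ | inj₂ (u′ , u⟶u′) = inj₂ (t ⊕ u′ , in-⊕ʳ u⟶u′)
... | inj₁ rt | inj₁ ru with 𝟘-or-zeroFree rt | 𝟘-or-zeroFree ru
...   | inj₁ refl | _         = inj₂ (⊕-reducible r-unit (σ₃ u u u) (⊕-comm 𝟘 u))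
...   | inj₂ _    | inj₁ refl = inj₂ (⊕-reducible r-unit (σ₃ t t t) refl)
...   | inj₂ zfT  | inj₂ zfU with meets-or-avoids t (occ u)
...     | inj₁ (_ , _ , pt , pu) = inj₂ (summands-cancel (occurs⇒summand t pt) (occurs⇒summand u pu))
...     | inj₂ avoids = inj₁ (⊕-reduced avoids (atMostOnce rt) (atMostOnce ru) zfT zfU)

normalise : ∀ t → ∃[ t′ ] (t ⟶! t′ × Reduced t′)
normalise t = go t (terminating t)
  where
  go : ∀ t → Acc (flip _⟶_) t → ∃[ t′ ] (t ⟶! t′ × Reduced t′)
  go t (acc smaller) with reduced-or-reducible t
  ... | inj₁ rt = t , (ε , reduced-irreducible rt) , rt
  ... | inj₂ (u , t⟶u) with go u (smaller t⟶u)
  ...   | t′ , (u⟶*t′ , t′-irreducible) , rt′ = t′ , (t⟶u ◅ u⟶*t′ , t′-irreducible) , rt′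

parity-injective-≤1 : ∀ {m n} → m ≤ 1 → n ≤ 1 → parity m ≡ parity n → m ≡ n
parity-injective-≤1 z≤n       z≤n       _  = refl
parity-injective-≤1 z≤n       (s≤s z≤n) ()
parity-injective-≤1 (s≤s z≤n) z≤n       ()
parity-injective-≤1 (s≤s z≤n) (s≤s z≤n) _  = refl

reduced-𝟘 : ∀ {t} → Reduced t → (∀ j q → Nonzero q → occ t j q ≡ 0) → t ≡ 𝟘
reduced-𝟘 {t} rt none with 𝟘-or-zeroFree rt
... | inj₁ t≡𝟘 = t≡𝟘
... | inj₂ zf with occurs-some t
...   | j , q , p = ⊥-elim (n≮0 (subst (0 <_) (none j q (zeroFree-nonzero {t} zf p)) p))

reduced-sameOcc : ∀ {a b} → Reduced a → Reduced b →
                  (∀ j q → Nonzero q → occ a j q ≡ occ b j q) → SameOcc a b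
reduced-sameOcc ra rb same with 𝟘-or-zeroFree ra | 𝟘-or-zeroFree rb
... | inj₁ refl | _ rewrite reduced-𝟘 rb (λ j q nz → ≡.trans (≡.sym (same j q nz)) (occ-𝟘 j nz)) =
  λ _ _ → refl
... | inj₂ _ | inj₁ refl rewrite reduced-𝟘 ra (λ j q nz → ≡.trans (same j q nz) (occ-𝟘 j nz)) =
  λ _ _ → refl
... | inj₂ zfa | inj₂ zfb = λ where
  j (V n) → same j (V n) tt
  j (C n) → same j (C n) tt
  j Z     → ≡.trans (zfa j) (≡.sym (zfb j))

reduced-unique : ∀ {a b} → Reduced a → Reduced b → a ≈R₂ACh b → a ≈ACh b
reduced-unique {a} {b} ra rb a≈b = ≈ACh-complete a b (reduced-sameOcc ra rb same)
  where
  same : ∀ j q → Nonzero q → occ a j q ≡ occ b j q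
  same j q nz = parity-injective-≤1 (atMostOnce ra j q) (atMostOnce rb j q) (parity-≈R₂ACh a≈b j q nz)

mainTheorem3 : Terminating
    × (∀ s t → s ≈R₂ACh t → ∃[ s' ] ∃[ t' ] (s ⟶! s' × t ⟶! t' × s' ≈ACh t'))
mainTheorem3 = terminating , joinable
  where
  joinable : ∀ s t → s ≈R₂ACh t → ∃[ s′ ] ∃[ t′ ] (s ⟶! s′ × t ⟶! t′ × s′ ≈ACh t′)
  joinable s t s≈t with normalise s | normalise t
  ... | s′ , s⟶!s′ , rs′ | t′ , t⟶!t′ , rt′ =
    s′ , t′ , s⟶!s′ , t⟶!t′ , reduced-unique rs′ rt′ s′≈t′
    where
    s′≈t′ : s′ ≈R₂ACh t′
    s′≈t′ = trans (sym (⟶*⇒≈R₂ACh (proj₁ s⟶!s′))) (trans s≈t (⟶*⇒≈R₂ACh (proj₁ t⟶!t′)))
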